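{- Let $m\neq n$ be positive integers, let $G$ be a group of order $v=2mn+1$, and let $\Pi$ be an Archdeacon embedding of $K_v$ (arising from a Heffter array over $G$ with compatible orderings) such that every edge lies on a face whose boundary is an $m$-cycle and on a face whose boundary is an $n$-cycle. Then every orientation-reversing automorphism $\sigma$ of $\Pi$ fixing the vertex $0$ fixes no vertex other than $0$.
   Context: A Heffter array $H(m',n';h,k)$ over a finite group $G$ (written additively) of order $2n'k+1$ is an $m'\times n'$ partially filled array with entries in $G$ such that each row has $h$ filled cells, each column has $k$ filled cells, every row and every column sums to $0$, and the multiset $\{\pm x: x$ an entry$\}$ contains each element of $G\setminus\{0\}$ exactly once. Let $\mathcal{E}(A)$ be the set of entries. Row orderings (cyclic orders of each row's entries) define a permutation $\omega_r$ of $\mathcal{E}(A)$ sending each entry to the next in its row; column orderings define $\omega_c$ similarly; they are compatible if $\omega_c\circ\omega_r$ is a single cycle of length $|\mathcal{E}(A)|$. The Archdeacon embedding is $\Pi=(K_v,\rho)$, where $K_v$ has vertex set $G$, $\rho((x,x+a))=(x,x+\rho_0(a))$ on oriented edges, and $\rho_0(a)=-\omega_r(a)$ if $a\in\mathcal{E}(A)$, $\rho_0(a)=\omega_c(-a)$ if $a\in-\mathcal{E}(A)$. Faces are the boundary walks given by the orbits of $(x,y)\mapsto(y,\rho_y(x))$ on oriented edges, where $\rho(y,z)=(y,\rho_y(z))$. An automorphism of $\Pi$ is a graph automorphism $\sigma$ of $K_v$ with either $\sigma\circ\rho=\rho\circ\sigma$ (orientation-preserving) or $\sigma\circ\rho=\rho^{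 -1}\circ\sigma$ (orientation-reversing) on all oriented edges. -}

module Defs where

open import Data.Nat using (ℕ; zero; suc; _+_; _*_)
open import Data.Fin using (Fin; _≟_)
open import Data.Maybe using (Maybe)
open import Data.List using (List; []; _∷_; length; filter; mapMaybe; concatMap; foldr)
open import Data.List.Membership.Propositional using (_∈_)
import Data.List.Membership.DecPropositional
open import Data.Fin.Base using (Fin)
open import Data.List.Base using (allFin)
open import Data.Product using (_×_; _,_; proj₁; proj₂; ∃; Σ)
open import Data.Sum using (_⊎_)
import Data.Sum
import Data.Fin
open import Data.Bool using (if_then_else_)
open import Relation.Nullary using (¬_; does)
open import Relation.Binary.PropositionalEquality using (_≡_; _≢_)
open import Algebra.Structures using (IsAbelianGroup)

iter : {A : Set} → (A → A) → ℕ → A → A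
iter f zero    a = a
iter f (suc k) a = f (iter f k a)

-- A finite abelian group of order v, represented on the carrier Fin v
-- (every group of order v is isomorphic to one of this form).
record FinAbGroup (v : ℕ) : Set where
  infixl 6 _+ᴳ_
  field
    _+ᴳ_ : Fin v → Fin v → Fin v
    0ᴳ   : Fin v
    -ᴳ_  : Fin v → Fin v
    isAbelianGroup : IsAbelianGroup _≡_ _+ᴳ_ 0ᴳ -ᴳ_

module _ {v : ℕ} (G : FinAbGroup v) where
  open FinAbGroup G
  module DecMem = Data.List.Membership.DecPropositional (_≟_ {v})

  occ : Fin v → List (Fin v) → ℕ
  occ g l = length (filter (g ≟_) l)

  CyclicOn : (Fin v → Set) → (Fin v → Fin v) → Set
  CyclicOn S f = (∀ a → S a → S (f a))
               × (∀ a b → S a → S b → ∃ λ k → iter f k a ≡ b)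

  record Heffter (m' n' h k : ℕ) : Set where
    field
      cell : Fin m' → Fin n' → Maybe (Fin v)
    rowEntries : Fin m' → List (Fin v)
    rowEntries i = mapMaybe (cell i) (allFin n')
    colEntries : Fin n' → List (Fin v)
    colEntries j = mapMaybe (λ i → cell i j) (allFin m')
    entries : List (Fin v)
    entries = concatMap rowEntries (allFin m')
    pmEntries : List (Fin v)
    pmEntries = concatMap (λ x → x ∷ -ᴳ x ∷ []) entries
    field
      order    : v ≡ 2 * n' * k + 1
      rowCount : ∀ i → length (rowEntries i) ≡ h
      colCount : ∀ j → length (colEntries j) ≡ k
      rowSum   : ∀ i → foldr _+ᴳ_ 0ᴳ (rowEntries i) ≡ 0ᴳ
      colSum   : ∀ j → foldr _+ᴳ_ 0ᴳ (colEntries j) ≡ 0ᴳ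
      pmZero    : occ 0ᴳ pmEntries ≡ 0
      pmNonzero : ∀ g → g ≢ 0ᴳ → occ g pmEntries ≡ 1

  module _ {m' n' h k : ℕ} (A : Heffter m' n' h k) where
    open Heffter A

    RowOrdering : (Fin v → Fin v) → Set
    RowOrdering ωr = ∀ i → CyclicOn (λ a → a ∈ rowEntries i) ωr

    ColOrdering : (Fin v → Fin v) → Set
    ColOrdering ωc = ∀ j → CyclicOn (λ a → a ∈ colEntries j) ωc

    Compatible : (Fin v → Fin v) → (Fin v → Fin v) → Set
    Compatible ωr ωc = CyclicOn (λ a → a ∈ entries) (λ a → ωc (ωr a))

    module _ (ωr ωc : Fin v → Fin v) where
      -- ρ₀(a) = -ω_r(a) if a ∈ E(A), ω_c(-a) if a ∈ -E(A)
      -- (E(A) and -E(A) partition G ∖ {0}; the value at 0 is irrelevant)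
      ρ₀ : Fin v → Fin v
      ρ₀ a = if does (a DecMem.∈? entries) then -ᴳ (ωr a) else ωc (-ᴳ a)

      -- rotation on oriented edges: ρ((x, x+a)) = (x, x+ρ₀(a))
      ρ : Fin v × Fin v → Fin v × Fin v
      ρ (x , y) = (x , x +ᴳ ρ₀ (-ᴳ x +ᴳ y))

      -- face-tracing map (x,y) ↦ (y, ρ_y(x))
      φ : Fin v × Fin v → Fin v × Fin v
      φ (x , y) = (y , proj₂ (ρ (y , x)))

      CycleFace : ℕ → Fin v × Fin v → Set
      CycleFace ℓ e = (iter φ ℓ e ≡ e)
                    × (∀ (i j : Fin ℓ) →
                         proj₁ (iter φ (Data.Fin.toℕ i) e)
                           ≡ proj₁ (iter φ (Data.Fin.toℕ j) e) → i ≡ j)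

      EdgeOnCycleFace : ℕ → Fin v → Fin v → Set
      EdgeOnCycleFace ℓ x y = CycleFace ℓ (x , y) Data.Sum.⊎ CycleFace ℓ (y , x)

      -- σ is orientation-reversing: σ∘ρ = ρ⁻¹∘σ on oriented edges,
      -- written equivalently (ρ is a bijection) as ρ∘σ∘ρ = σ
      OrientationReversing : (Fin v → Fin v) → Set
      OrientationReversing σ =
        ∀ x y → x ≢ y →
          ρ (σ (proj₁ (ρ (x , y))) , σ (proj₂ (ρ (x , y)))) ≡ (σ x , σ y)

-- An orientation-reversing automorphism σ fixing two adjacent vertices a and b maps
-- the face traced from the oriented edge (a , b) onto the face traced from (b , a),
-- walked backwards; so the two faces on the edge {a , b} have the same length.
-- Applied to the edge {0 , x}, whose faces must have lengths m and n (a single face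
-- cannot be both an m-cycle and an n-cycle), this forces m = n.
module Submission where

open import Defs
open import Data.Nat using (ℕ; zero; suc; _+_; _*_; _<_; _≤_; z<s)
open import Data.Nat.Properties using (≤-antisym; ≮⇒≥; <-trans; 1+n≢0; m≤n⇒m<n∨m≡n; n<1+n; m<n⇒m<1+n)
open import Data.Fin using (Fin; toℕ; fromℕ<; _≟_)
open import Data.Fin.Properties using (toℕ-fromℕ<)
open import Data.Product using (_×_; _,_; proj₁; proj₂)
open import Data.Sum using (inj₁; inj₂)
open import Data.Empty using (⊥-elim)
open import Function.Base using (_∘_)
open import Function.Definitions using (Bijective)
open import Relation.Nullary using (yes; no)
open import Relation.Binary.PropositionalEquality
  using (_≡_; _≢_; refl; sym; trans; cong; cong₂; subst; module ≡-Reasoning)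

iter-suc : {A : Set} (f : A → A) (k : ℕ) (a : A) → iter f (suc k) a ≡ iter f k (f a)
iter-suc f zero    a = refl
iter-suc f (suc k) a = cong f (iter-suc f k a)

module _ {A : Set} (f ψ : A → A) where

  iter-reverse : ∀ k e → (∀ j → j < k → f (ψ (f (iter f j e))) ≡ ψ (iter f j e)) →
                 iter f k (ψ (iter f k e)) ≡ ψ e
  iter-reverse zero    e reverses = refl
  iter-reverse (suc k) e reverses = begin
    iter f (suc k) (ψ (iter f (suc k) e))  ≡⟨ iter-suc f k _ ⟩
    iter f k (f (ψ (f (iter f k e))))      ≡⟨ cong (iter f k) (reverses k (n<1+n k)) ⟩
    iter f k (ψ (iter f k e))              ≡⟨ iter-reverse k e (λ j → reverses j ∘ m<n⇒m<1+n) ⟩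
    ψ e                                    ∎
    where open ≡-Reasoning

  periodic-reverse : ∀ {ℓ e} → iter f ℓ e ≡ e →
                     (∀ j → j < ℓ → f (ψ (f (iter f j e))) ≡ ψ (iter f j e)) →
                     iter f ℓ (ψ e) ≡ ψ e
  periodic-reverse {ℓ} {e} period reverses =
    subst (λ w → iter f ℓ (ψ w) ≡ ψ e) period (iter-reverse ℓ e reverses)

module _ {B : Set} (f : B × B → B × B) where

  CycleOf : ℕ → B × B → Set
  CycleOf ℓ e = (iter f ℓ e ≡ e)
              × (∀ (i j : Fin ℓ) →
                   proj₁ (iter f (toℕ i) e) ≡ proj₁ (iter f (toℕ j) e) → i ≡ j)

  cycle-injective : ∀ {ℓ e i j} → CycleOf ℓ e → i < ℓ → j < ℓ →
                    proj₁ (iter f i e) ≡ proj₁ (iter f j e) → i ≡ j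
  cycle-injective {ℓ} {e} {i} {j} (_ , distinct) i<ℓ j<ℓ eq = begin
    i                 ≡⟨ sym (toℕ-fromℕ< i<ℓ) ⟩
    toℕ (fromℕ< i<ℓ)  ≡⟨ cong toℕ (distinct _ _ eq′) ⟩
    toℕ (fromℕ< j<ℓ)  ≡⟨ toℕ-fromℕ< j<ℓ ⟩
    j                 ∎
    where
      open ≡-Reasoning
      eq′ : proj₁ (iter f (toℕ (fromℕ< i<ℓ)) e) ≡ proj₁ (iter f (toℕ (fromℕ< j<ℓ)) e)
      eq′ rewrite toℕ-fromℕ< i<ℓ | toℕ-fromℕ< j<ℓ = eq

  cycle-length-≤-period : ∀ {ℓ p e} → 0 < p → iter f p e ≡ e → CycleOf ℓ e → ℓ ≤ p
  cycle-length-≤-period {p = suc p} _ period cycle = ≮⇒≥ λ p<ℓ →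
    1+n≢0 (cycle-injective cycle p<ℓ (<-trans z<s p<ℓ) (cong proj₁ period))

  cycle-length-unique : ∀ {ℓ ℓ′ e} → 0 < ℓ → 0 < ℓ′ → CycleOf ℓ e → CycleOf ℓ′ e → ℓ ≡ ℓ′
  cycle-length-unique 0<ℓ 0<ℓ′ cycle cycle′ =
    ≤-antisym (cycle-length-≤-period 0<ℓ′ (proj₁ cycle′) cycle)
              (cycle-length-≤-period 0<ℓ (proj₁ cycle) cycle′)

  -- For a face-tracing map each step starts where the previous one ended, so a cycle
  -- through a proper edge visits only proper edges.
  module _ (walk : ∀ p → proj₁ (f p) ≡ proj₂ p) where

    cycle-edges-proper : ∀ {ℓ e} → proj₁ e ≢ proj₂ e → CycleOf ℓ e →
                         ∀ j → j < ℓ → proj₁ (iter f j e) ≢ proj₂ (iter f j e)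
    cycle-edges-proper proper cycle j j<ℓ loop with m≤n⇒m<n∨m≡n j<ℓ
    ... | inj₁ 1+j<ℓ with cycle-injective cycle j<ℓ 1+j<ℓ (trans loop (sym (walk _)))
    ...   | ()
    cycle-edges-proper proper cycle zero j<ℓ loop | inj₂ refl = proper loop
    cycle-edges-proper proper cycle (suc j) j<ℓ loop | inj₂ refl
      with cycle-injective cycle j<ℓ z<s
             (trans loop (trans (sym (walk _)) (cong proj₁ (proj₁ cycle))))
    ... | ()

module _ {v : ℕ} (G : FinAbGroup v) {m' n' h k : ℕ} (A : Heffter G m' n' h k)
         (ωr ωc : Fin v → Fin v) (σ : Fin v → Fin v)
         (reversing : OrientationReversing G A ωr ωc σ) where

  reverse : Fin v × Fin v → Fin v × Fin v
  reverse (x , y) = (σ y , σ x)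

  φ-reverse : ∀ p → proj₁ p ≢ proj₂ p →
              φ G A ωr ωc (reverse (φ G A ωr ωc p)) ≡ reverse p
  φ-reverse (x , y) x≢y = cong (λ r → (σ y , proj₂ r)) (reversing y x (x≢y ∘ sym))

  reversed-face-length-≤ : ∀ {ℓ ℓ′ a b} → 0 < ℓ → σ a ≡ a → σ b ≡ b → a ≢ b →
                           CycleFace G A ωr ωc ℓ (a , b) →
                           CycleFace G A ωr ωc ℓ′ (b , a) → ℓ′ ≤ ℓ
  reversed-face-length-≤ {ℓ} {a = a} {b} 0<ℓ σa σb a≢b face face′ =
    cycle-length-≤-period Φ 0<ℓ closes face′
    where
      Φ : Fin v × Fin v → Fin v × Fin v
      Φ = φ G A ωr ωc
      closes : iter Φ ℓ (b , a) ≡ (b , a)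
      closes = subst (λ w → iter Φ ℓ w ≡ w) (cong₂ _,_ σb σa)
                 (periodic-reverse Φ reverse (proj₁ face)
                   (λ j j<ℓ → φ-reverse _
                     (cycle-edges-proper Φ (λ _ → refl) a≢b face j j<ℓ)))

  fixed-edge-face-lengths : ∀ {ℓ ℓ′ a b} → 0 < ℓ → 0 < ℓ′ → σ a ≡ a → σ b ≡ b → a ≢ b →
                            CycleFace G A ωr ωc ℓ (a , b) →
                            CycleFace G A ωr ωc ℓ′ (b , a) → ℓ ≡ ℓ′
  fixed-edge-face-lengths 0<ℓ 0<ℓ′ σa σb a≢b face face′ =
    ≤-antisym (reversed-face-length-≤ 0<ℓ′ σb σa (a≢b ∘ sym) face′ face)
              (reversed-face-length-≤ 0<ℓ σa σb a≢b face face′)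

lemma3p5 : (m n : ℕ) → 0 < m → 0 < n → m ≢ n →
    (G : FinAbGroup (2 * m * n + 1)) →
    {m' n' h k : ℕ} (A : Heffter G m' n' h k) →
    (ωr ωc : Fin (2 * m * n + 1) → Fin (2 * m * n + 1)) →
    RowOrdering G A ωr → ColOrdering G A ωc → Compatible G A ωr ωc →
    (∀ x y → x ≢ y →
       EdgeOnCycleFace G A ωr ωc m x y × EdgeOnCycleFace G A ωr ωc n x y) →
    (σ : Fin (2 * m * n + 1) → Fin (2 * m * n + 1)) → Bijective _≡_ _≡_ σ →
    OrientationReversing G A ωr ωc σ →
    σ (FinAbGroup.0ᴳ G) ≡ FinAbGroup.0ᴳ G →
    ∀ x → σ x ≡ x → x ≡ FinAbGroup.0ᴳ G
lemma3p5 m n 0<m 0<n m≢n G A ωr ωc _ _ _ faces σ _ reversing σ0 x σx with x ≟ FinAbGroup.0ᴳ G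
... | yes x≡0 = x≡0
... | no x≢0 = ⊥-elim (m≢n (face-lengths (faces 0ᴳ x (x≢0 ∘ sym))))
  where
    open FinAbGroup G
    Φ : Fin (2 * m * n + 1) × Fin (2 * m * n + 1) → Fin (2 * m * n + 1) × Fin (2 * m * n + 1)
    Φ = φ G A ωr ωc
    face-lengths : EdgeOnCycleFace G A ωr ωc m 0ᴳ x × EdgeOnCycleFace G A ωr ωc n 0ᴳ x →
                   m ≡ n
    face-lengths (inj₁ fm , inj₁ fn) = cycle-length-unique Φ 0<m 0<n fm fn
    face-lengths (inj₂ fm , inj₂ fn) = cycle-length-unique Φ 0<m 0<n fm fn
    face-lengths (inj₁ fm , inj₂ fn) =
      fixed-edge-face-lengths G A ωr ωc σ reversing 0<m 0<n σ0 σx (x≢0 ∘ sym) fm fn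
    face-lengths (inj₂ fm , inj₁ fn) =
      fixed-edge-face-lengths G A ωr ωc σ reversing 0<m 0<n σx σ0 x≢0 fm fn
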